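{- Let $l\ge 1$ and $0\le k\le l$, and let $s$ be a $k$-switching of the switching model $\mathcal S_l$. Then $\mathcal S_l,s\not\models S_k$, but for every proper subset $t\subsetneq s$ we have $\mathcal S_l,t\models S_k$.
   Context: Inquisitive propositional formulas: $\phi::=\bot\mid p\mid \phi\land\phi\mid \phi\vee\!\!\!\vee\phi\mid\phi\to\phi$ ($\vee\!\!\!\vee$ is inquisitive disjunction), with $\neg\phi:=\phi\to\bot$. For a model $M=(W,V)$ ($W$ non-empty set, $V$ assigning to each atom a subset of $W$) and a state $s\subseteq W$: $M,s\models\bot$ iff $s=\emptyset$; $M,s\models p$ iff $s\subseteq V(p)$; $\land$ is componentwise; $M,s\models\phi\vee\!\!\!\vee\psi$ iff $M,s\models\phi$ or $M,s\models\psi$; $M,s\models\phi\to\psi$ iff for all $t\subseteq s$, $M,t\models\phi$ implies $M,t\models\psi$. The switching model $\mathcal S_l=(W_l,V_l)$ over atoms $p_0,\dots,p_{l-1},q_0,\dots,q_{l-1}$ has $W_l=\{w_0^+,w_0^-,\dots,w_{l-1}^+,w_{l-1}^-\}$, $V_l(p_i)=\{w_i^+\}$, $V_l(q_i)=\{w_i^+,w_i^-\}$. For $k\le l$, a $k$-switching of $\mathcal S_l$ is a state $s$ such that for each $i<k$, $s$ contains exactly one of $w_i^+,w_i^-$, and for each $k\le i<l$, $s$ contains both $w_i^+$ and $w_i^-$. Let $C_i^+:=q_i\land p_i$ and $C_i^-:=q_i\land\neg p_i$. Define $S_0:=\bigvee\!\!\!\vee_{i=0}^{l-1}(\neg C_i^+\vee\!\!\!\vee\neg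 C_i^-)$; for $0<k<l$, $S_k:=\bigvee\!\!\!\vee_{i=0}^{k-1}(\neg C_i^+\land\neg C_i^-)\ \vee\!\!\!\vee\ \bigvee\!\!\!\vee_{i=k}^{l-1}(\neg C_i^+\vee\!\!\!\vee\neg C_i^-)$; and $S_l:=\bigvee\!\!\!\vee_{i=0}^{l-1}(\neg C_i^+\land\neg C_i^-)$, where $\bigvee\!\!\!\vee$ denotes iterated inquisitive disjunction. -}

module Defs where

open import Data.Nat using (ℕ; _<_; _<?_; _≤_)
open import Data.Fin using (Fin; toℕ)
open import Data.Bool using (Bool; true; false; if_then_else_)
open import Data.Product using (_×_; _,_; Σ)
open import Data.Sum using (_⊎_)
open import Data.List using (List; []; _∷_; allFin)
open import Data.Empty using (⊥)
open import Relation.Nullary using (¬_)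
open import Relation.Nullary.Decidable using (⌊_⌋)
open import Relation.Binary.PropositionalEquality using (_≡_)

data Form (A : Set) : Set where
  ⊥f   : Form A
  atom : A → Form A
  _∧f_ : Form A → Form A → Form A
  _⩔_  : Form A → Form A → Form A
  _⇒_  : Form A → Form A → Form A

¬f : ∀ {A} → Form A → Form A
¬f φ = φ ⇒ ⊥f

-- Models: a set of worlds W and a valuation; a state is a subset of W,
-- represented by its (decidable) characteristic function W → Bool.
record Model (A : Set) : Set₁ where
  field
    W : Set
    V : A → W → Bool

State : Set → Set
State W = W → Bool

_⊆_ : {W : Set} → State W → State W → Set
t ⊆ s = ∀ w → t w ≡ true → s w ≡ true

_⊊_ : {W : Set} → State W → State W → Set
t ⊊ s = t ⊆ s × ¬ (s ⊆ t)

_,_⊨_ : ∀ {A} (M : Model A) → State (Model.W M) → Form A → Set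
M , s ⊨ ⊥f = ∀ w → s w ≡ false
M , s ⊨ atom a = ∀ w → s w ≡ true → Model.V M a w ≡ true
M , s ⊨ (φ ∧f ψ) = (M , s ⊨ φ) × (M , s ⊨ ψ)
M , s ⊨ (φ ⩔ ψ) = (M , s ⊨ φ) ⊎ (M , s ⊨ ψ)
M , s ⊨ (φ ⇒ ψ) = ∀ t → t ⊆ s → M , t ⊨ φ → M , t ⊨ ψ

-- Iterated inquisitive disjunction of a nonempty list (⊥ for the empty list,
-- which never occurs below since l ≥ 1).
⩔-list : ∀ {A} → List (Form A) → Form A
⩔-list [] = ⊥f
⩔-list (φ ∷ []) = φ
⩔-list (φ ∷ ψ ∷ φs) = φ ⩔ ⩔-list (ψ ∷ φs)

data Atom (l : ℕ) : Set where
  p : Fin l → Atom l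
  q : Fin l → Atom l

-- world (i , true) is w_i^+, world (i , false) is w_i^-
World : ℕ → Set
World l = Fin l × Bool

Vₗ : ∀ {l} → Atom l → World l → Bool
Vₗ (p i) (j , b) = if ⌊ toℕ i Data.Nat.≟ toℕ j ⌋ then b else false
Vₗ (q i) (j , b) = ⌊ toℕ i Data.Nat.≟ toℕ j ⌋

𝒮 : (l : ℕ) → Model (Atom l)
𝒮 l = record { W = World l ; V = Vₗ }

IsSwitching : (l k : ℕ) → State (World l) → Set
IsSwitching l k s = ∀ (i : Fin l) →
  (toℕ i < k → (s (i , true) ≡ true × s (i , false) ≡ false)
             ⊎ (s (i , true) ≡ false × s (i , false) ≡ true))
  × (k ≤ toℕ i → s (i , true) ≡ true × s (i , false) ≡ true)

C⁺ C⁻ : ∀ {l} → Fin l → Form (Atom l)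
C⁺ i = atom (q i) ∧f atom (p i)
C⁻ i = atom (q i) ∧f ¬f (atom (p i))

Dis : ∀ {l} → ℕ → Fin l → Form (Atom l)
Dis k i = if ⌊ toℕ i <? k ⌋ then (¬f (C⁺ i) ∧f ¬f (C⁻ i)) else (¬f (C⁺ i) ⩔ ¬f (C⁻ i))

S : (l k : ℕ) → Form (Atom l)
S l k = ⩔-list (Data.List.map (Dis k) (allFin l))

{-# OPTIONS --safe #-}
module Submission where

open import Defs
open import Data.Nat using (ℕ; zero; suc; _≤_; _<_; _<?_)
open import Data.Nat.Properties using (≮⇒≥)
import Data.Nat as ℕ
open import Data.Fin using (Fin; toℕ)
import Data.Fin as Fin
open import Data.Fin.Properties using (toℕ-injective; ¬∀⟶∃¬)
open import Data.Bool using (Bool; true; false; not; if_then_else_)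
import Data.Bool as Bool
open import Data.Bool.Properties using (not-¬; ¬-not)
open import Data.Product using (_×_; _,_; proj₁; proj₂; ∃)
open import Data.Product.Properties using (≡-dec)
open import Data.Sum using (inj₁; inj₂; [_,_])
import Data.Sum as Sum
open import Data.List using ([]; _∷_; allFin)
open import Data.List.Relation.Unary.Any using (Any; here; there; satisfied)
open import Data.List.Relation.Unary.Any.Properties using (map⁺; map⁻)
open import Data.List.Membership.Propositional using (lose)
open import Data.List.Membership.Propositional.Properties using (∈-allFin)
open import Function.Bundles using (_⇔_; mk⇔; Equivalence)
open import Relation.Nullary using (¬_; Dec; does; yes; no; contradiction)
open import Relation.Nullary.Decidable using (isYes≗does; dec-true; _×-dec_; _→-dec_)
open import Relation.Binary.Definitions using (DecidableEquality)
open import Relation.Binary.PropositionalEquality using (_≡_; refl; sym; trans; cong; subst)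

open Equivalence using (to; from)

-- A state supports ¬C⁺ᵢ (resp. ¬C⁻ᵢ) iff it omits w⁺ᵢ (resp. w⁻ᵢ), the only world at
-- which C⁺ᵢ (resp. C⁻ᵢ) is true. Hence the i-th disjunct of S_k is supported exactly by
-- the states omitting both worlds of index i when i < k, and one of them when i ≥ k.
-- A k-switching omits exactly one world of each index below k and none above, so it
-- supports no disjunct. A proper substate t omits some world (i , b) of s; this suffices
-- if i ≥ k, and if i < k the other world of index i is already missing from s, hence from t.

⊆-false : ∀ {W} {s t : State W} → t ⊆ s → ∀ w → s w ≡ false → t w ≡ false
⊆-false t⊆s w s∌w = ¬-not λ t∋w → not-¬ (t⊆s w t∋w) s∌w

module _ {A : Set} {M : Model A} where
  open Model M using (W)

  ⊨-mono : ∀ φ {s t : State W} → t ⊆ s → M , s ⊨ φ → M , t ⊨ φ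
  ⊨-mono ⊥f       t⊆s s⊨ w         = ⊆-false t⊆s w (s⊨ w)
  ⊨-mono (atom a) t⊆s s⊨ w t∋w     = s⊨ w (t⊆s w t∋w)
  ⊨-mono (φ ∧f ψ) t⊆s (s⊨φ , s⊨ψ) = ⊨-mono φ t⊆s s⊨φ , ⊨-mono ψ t⊆s s⊨ψ
  ⊨-mono (φ ⩔ ψ)  t⊆s              = Sum.map (⊨-mono φ t⊆s) (⊨-mono ψ t⊆s)
  ⊨-mono (φ ⇒ ψ)  t⊆s s⊨ u u⊆t     = s⊨ u λ w u∋w → t⊆s w (u⊆t w u∋w)

  ⊨-⩔-list : ∀ φ φs {s : State W} →
             M , s ⊨ ⩔-list (φ ∷ φs) ⇔ Any (λ ψ → M , s ⊨ ψ) (φ ∷ φs)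
  ⊨-⩔-list φ φs = mk⇔ (to′ φ φs) (from′ φ φs)
    where
    to′ : ∀ φ φs {s} → M , s ⊨ ⩔-list (φ ∷ φs) → Any (λ ψ → M , s ⊨ ψ) (φ ∷ φs)
    to′ φ []       s⊨         = here s⊨
    to′ φ (ψ ∷ φs) (inj₁ s⊨φ) = here s⊨φ
    to′ φ (ψ ∷ φs) (inj₂ s⊨)  = there (to′ ψ φs s⊨)
    from′ : ∀ φ φs {s} → Any (λ ψ → M , s ⊨ ψ) (φ ∷ φs) → M , s ⊨ ⩔-list (φ ∷ φs)
    from′ φ []       (here s⊨φ) = s⊨φ
    from′ φ (ψ ∷ φs) (here s⊨φ) = inj₁ s⊨φ
    from′ φ (ψ ∷ φs) (there s⊨) = inj₂ (from′ ψ φs s⊨)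

  module Singletons (_≟_ : DecidableEquality W) where
    ｛_｝ : W → State W
    ｛ w ｝ v = does (v ≟ w)

    ｛w｝∋w : ∀ w → ｛ w ｝ w ≡ true
    ｛w｝∋w w = dec-true (w ≟ w) refl

    ｛w｝∋v⇒v≡w : ∀ {v w} → ｛ w ｝ v ≡ true → v ≡ w
    ｛w｝∋v⇒v≡w {v} {w} ｛w｝∋v with v ≟ w
    ... | yes v≡w = v≡w
    ... | no _    = contradiction ｛w｝∋v λ ()

    ｛｝⊆ : ∀ {s : State W} {w} → s w ≡ true → ｛ w ｝ ⊆ s
    ｛｝⊆ {s} s∋w v ｛w｝∋v = subst (λ u → s u ≡ true) (sym (｛w｝∋v⇒v≡w ｛w｝∋v)) s∋w

    ⊨-｛｝-atom : ∀ a w → M , ｛ w ｝ ⊨ atom a ⇔ Model.V M a w ≡ true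
    ⊨-｛｝-atom a w = mk⇔
      (λ ⊨a → ⊨a w (｛w｝∋w w))
      (λ Va∋w v ｛w｝∋v → subst (λ u → Model.V M a u ≡ true) (sym (｛w｝∋v⇒v≡w ｛w｝∋v)) Va∋w)

    ⊨¬ : ∀ {φ} {s : State W} → M , s ⊨ ¬f φ ⇔ (∀ w → s w ≡ true → ¬ (M , ｛ w ｝ ⊨ φ))
    ⊨¬ {φ} = mk⇔
      (λ s⊨¬φ w s∋w ｛w｝⊨φ → not-¬ (｛w｝∋w w) (s⊨¬φ ｛ w ｝ (｛｝⊆ s∋w) ｛w｝⊨φ w))
      (λ no-w t t⊆s t⊨φ w → ¬-not λ t∋w → no-w w (t⊆s w t∋w) (⊨-mono φ (｛｝⊆ t∋w) t⊨φ))

    ⊨-｛｝-¬ : ∀ φ w → M , ｛ w ｝ ⊨ ¬f φ ⇔ (¬ (M , ｛ w ｝ ⊨ φ))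
    ⊨-｛｝-¬ φ w = mk⇔
      (λ ⊨¬φ → to ⊨¬ ⊨¬φ w (｛w｝∋w w))
      (λ ⊭φ → from ⊨¬ λ v ｛w｝∋v → subst (λ u → ¬ (M , ｛ u ｝ ⊨ φ)) (sym (｛w｝∋v⇒v≡w ｛w｝∋v)) ⊭φ)

module _ {l : ℕ} where
  _≟ᵂ_ : DecidableEquality (World l)
  _≟ᵂ_ = ≡-dec Fin._≟_ Bool._≟_

  open Singletons {M = 𝒮 l} _≟ᵂ_

  C : Bool → Fin l → Form (Atom l)
  C true  = C⁺
  C false = C⁻

  Vq⇒≡ : ∀ {i j : Fin l} {b} → Vₗ (q i) (j , b) ≡ true → i ≡ j
  Vq⇒≡ {i} {j} Vq∋ with toℕ i ℕ.≟ toℕ j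
  ... | yes i≡j = toℕ-injective i≡j
  ... | no _    = contradiction Vq∋ λ ()

  Vq-refl : ∀ (i : Fin l) b → Vₗ (q i) (i , b) ≡ true
  Vq-refl i b = trans (isYes≗does (toℕ i ℕ.≟ toℕ i)) (dec-true (toℕ i ℕ.≟ toℕ i) refl)

  Vp-refl : ∀ (i : Fin l) b → Vₗ (p i) (i , b) ≡ b
  Vp-refl i b = cong (if_then b else false) (Vq-refl i b)

  ｛｝⊨C : ∀ b i → 𝒮 l , ｛ (i , b) ｝ ⊨ C b i
  ｛｝⊨C true  i = from (⊨-｛｝-atom (q i) (i , true)) (Vq-refl i true)
                 , from (⊨-｛｝-atom (p i) (i , true)) (Vp-refl i true)
  ｛｝⊨C false i = from (⊨-｛｝-atom (q i) (i , false)) (Vq-refl i false)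
                 , from (⊨-｛｝-¬ (atom (p i)) (i , false)) λ ⊨p →
                     contradiction (trans (sym (Vp-refl i false)) (to (⊨-｛｝-atom (p i) (i , false)) ⊨p))
                                   λ ()

  ｛｝⊨C⇒≡ : ∀ {b i w} → 𝒮 l , ｛ w ｝ ⊨ C b i → w ≡ (i , b)
  ｛｝⊨C⇒≡ {true} {i} {j , b} (⊨q , ⊨p) with Vq⇒≡ {i} {j} {b} (to (⊨-｛｝-atom (q i) (j , b)) ⊨q)
  ... | refl = cong (i ,_) (trans (sym (Vp-refl i b)) (to (⊨-｛｝-atom (p i) (i , b)) ⊨p))
  ｛｝⊨C⇒≡ {false} {i} {j , b} (⊨q , ⊨¬p) with Vq⇒≡ {i} {j} {b} (to (⊨-｛｝-atom (q i) (j , b)) ⊨q)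
  ... | refl = cong (i ,_) (¬-not λ b≡true →
    to (⊨-｛｝-¬ (atom (p i)) (i , b)) ⊨¬p
       (from (⊨-｛｝-atom (p i) (i , b)) (trans (Vp-refl i b) b≡true)))

  ∋⇒⊭¬C : ∀ {t : State (World l)} {i b} → t (i , b) ≡ true → ¬ (𝒮 l , t ⊨ ¬f (C b i))
  ∋⇒⊭¬C {i = i} {b} t∋ t⊨¬C = to ⊨¬ t⊨¬C (i , b) t∋ (｛｝⊨C b i)

  ∌⇒⊨¬C : ∀ {t : State (World l)} {i b} → t (i , b) ≡ false → 𝒮 l , t ⊨ ¬f (C b i)
  ∌⇒⊨¬C {t} t∌ = from ⊨¬ λ w t∋w ｛w｝⊨C →
    not-¬ t∋w (subst (λ v → t v ≡ false) (sym (｛｝⊨C⇒≡ ｛w｝⊨C)) t∌)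

  data DisjunctView (k : ℕ) (i : Fin l) : Form (Atom l) → Set where
    below : toℕ i < k → DisjunctView k i (¬f (C⁺ i) ∧f ¬f (C⁻ i))
    above : k ≤ toℕ i → DisjunctView k i (¬f (C⁺ i) ⩔ ¬f (C⁻ i))

  disjunctView : ∀ k i → DisjunctView k i (Dis k i)
  disjunctView k i with toℕ i <? k
  ... | yes i<k = below i<k
  ... | no  i≮k = above (≮⇒≥ i≮k)

  switching-⊭Dis : ∀ {k s} → IsSwitching l k s → ∀ i → ¬ (𝒮 l , s ⊨ Dis k i)
  switching-⊭Dis {k} sw i with Dis k i | disjunctView k i
  ... | _ | below i<k = λ (⊨¬C⁺ , ⊨¬C⁻) →
    [ (λ (s∋⁺ , _) → ∋⇒⊭¬C s∋⁺ ⊨¬C⁺) , (λ (_ , s∋⁻) → ∋⇒⊭¬C s∋⁻ ⊨¬C⁻) ] (proj₁ (sw i) i<k)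
  ... | _ | above k≤i = let (s∋⁺ , s∋⁻) = proj₂ (sw i) k≤i in [ ∋⇒⊭¬C s∋⁺ , ∋⇒⊭¬C s∋⁻ ]

  switching-unique : ∀ {k s i b} → IsSwitching l k s → toℕ i < k →
                     s (i , b) ≡ true → s (i , not b) ≡ false
  switching-unique {i = i} {true} sw i<k s∋ =
    [ proj₂ , (λ (s∌ , _) → contradiction s∌ (not-¬ s∋)) ] (proj₁ (sw i) i<k)
  switching-unique {i = i} {false} sw i<k s∋ =
    [ (λ (_ , s∌) → contradiction s∌ (not-¬ s∋)) , proj₁ ] (proj₁ (sw i) i<k)

  omitted-⊨Dis : ∀ {k s t} i b → IsSwitching l k s → t ⊆ s →
                 s (i , b) ≡ true → t (i , b) ≡ false → 𝒮 l , t ⊨ Dis k i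
  omitted-⊨Dis {k} i b sw t⊆s s∋ t∌ with Dis k i | disjunctView k i
  omitted-⊨Dis i true  sw t⊆s s∋ t∌ | _ | above _ = inj₁ (∌⇒⊨¬C t∌)
  omitted-⊨Dis i false sw t⊆s s∋ t∌ | _ | above _ = inj₂ (∌⇒⊨¬C t∌)
  omitted-⊨Dis {s = s} {t} i true  sw t⊆s s∋ t∌ | _ | below i<k =
    ∌⇒⊨¬C t∌ ,
    ∌⇒⊨¬C (⊆-false {s = s} {t = t} t⊆s (i , false) (switching-unique {s = s} sw i<k s∋))
  omitted-⊨Dis {s = s} {t} i false sw t⊆s s∋ t∌ | _ | below i<k =
    ∌⇒⊨¬C (⊆-false {s = s} {t = t} t⊆s (i , true) (switching-unique {s = s} sw i<k s∋)) ,
    ∌⇒⊨¬C t∌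

¬⇒-witness : ∀ {a b : Bool} → ¬ (a ≡ true → b ≡ true) → a ≡ true × b ≡ false
¬⇒-witness {true}  {false} _     = refl , refl
¬⇒-witness {true}  {true}  ¬a⇒b = contradiction (λ _ → refl) ¬a⇒b
¬⇒-witness {false}         ¬a⇒b = contradiction (λ ()) ¬a⇒b

⊈-witness : ∀ {l} {s t : State (World l)} → ¬ (s ⊆ t) → ∃ λ w → s w ≡ true × t w ≡ false
⊈-witness {l} {s} {t} s⊈t =
  pick (¬∀⟶∃¬ l KeptAt (λ i → kept? (i , true) ×-dec kept? (i , false)) λ keptAll →
    s⊈t λ { (i , true) → proj₁ (keptAll i) ; (i , false) → proj₂ (keptAll i) })
  where
  Kept : World l → Set
  Kept w = s w ≡ true → t w ≡ true

  kept? : ∀ w → Dec (Kept w)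
  kept? w = (s w Bool.≟ true) →-dec (t w Bool.≟ true)

  KeptAt : Fin l → Set
  KeptAt i = Kept (i , true) × Kept (i , false)

  pick : (∃ λ i → ¬ KeptAt i) → ∃ λ w → s w ≡ true × t w ≡ false
  pick (i , ¬kept) with kept? (i , true)
  ... | no ¬kept⁺ = (i , true) , ¬⇒-witness ¬kept⁺
  ... | yes kept⁺ = (i , false) , ¬⇒-witness λ kept⁻ → ¬kept (kept⁺ , kept⁻)

⊨S⇔∃Dis : ∀ {n k t} → 𝒮 (suc n) , t ⊨ S (suc n) k ⇔ (∃ λ i → 𝒮 (suc n) , t ⊨ Dis k i)
⊨S⇔∃Dis {n} {k} = mk⇔
  (λ t⊨S → satisfied (map⁻ {xs = allFin (suc n)} (to (⊨-⩔-list _ _) t⊨S)))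
  (λ (i , t⊨Dis) →
    from (⊨-⩔-list _ _) (map⁺ {f = Dis k} {xs = allFin (suc n)} (lose (∈-allFin i) t⊨Dis)))

lemma4p4 : (l k : ℕ) → 1 ≤ l → k ≤ l → (s : State (World l)) → IsSwitching l k s →
    (¬ (𝒮 l , s ⊨ S l k)) × (∀ t → t ⊊ s → 𝒮 l , t ⊨ S l k)
lemma4p4 zero    _ ()
lemma4p4 (suc n) k _ _ s sw = s⊭S , t⊨S
  where
  s⊭S : ¬ (𝒮 (suc n) , s ⊨ S (suc n) k)
  s⊭S s⊨S = let (i , s⊨Dis) = to ⊨S⇔∃Dis s⊨S in switching-⊭Dis sw i s⊨Dis

  t⊨S : ∀ t → t ⊊ s → 𝒮 (suc n) , t ⊨ S (suc n) k
  t⊨S t (t⊆s , s⊈t) =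
    let ((i , b) , s∋ , t∌) = ⊈-witness s⊈t
    in  from ⊨S⇔∃Dis (i , omitted-⊨Dis i b sw t⊆s s∋ t∌)
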